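{- Let $U$ be a set, $k\ge1$, $t\ge2$, $\rho_t=(\sigma_1,\dots,\sigma_t)\in U^t$ and $\rho_{t-1}=(\sigma_1,\dots,\sigma_{t-1})$. Let $\mathcal I_{t-1}$ be a hierarchical service pattern over $[1,t)$ and let $\mathcal I_t$ be its $\ell_t$-extension for some $\ell_t\in\{0,\dots,k\}$. Then for every $\ell\in\{\ell_t+1,\dots,k\}$ and every $p^{\ell+1},\dots,p^k\in U$, $$Q^\ell_t(p^{\ell+1},\dots,p^k)\subseteq Q^\ell_{t-1}(p^{\ell+1},\dots,p^k),$$ where $Q^\ell_t$ is taken with respect to $(\mathcal I_t,\rho_t)$ and $Q^\ell_{t-1}$ with respect to $(\mathcal I_{t-1},\rho_{t-1})$.
   Context: A hierarchical service pattern over $[1,s+1)$ is a $k$-tuple $\mathcal I=(\mathcal I^1,\dots,\mathcal I^k)$ where each $\mathcal I^\ell$ is a partition of $[1,s+1)$ into left-closed right-open intervals with integer endpoints, and $\mathcal I^\ell$ refines $\mathcal I^{\ell+1}$ for each $\ell<k$. For a pattern $\mathcal I_{t-1}$ over $[1,t)$ with last intervals $L^i_{t-1}\in\mathcal I^i_{t-1}$ and $\ell\in\{0,\dots,k\}$, its $\ell$-extension $\mathcal I_t$ over $[1,t+1)$ has $\mathcal I_t^i=\mathcal I_{t-1}^i\cup\{[t,t+1)\}$ for $i\le\ell$ and $\mathcal I_t^i=(\mathcal I_{t-1}^i\setminus\{L^i_{t-1}\})\cup\{L^i_{t-1}\cup[t,t+1)\}$ for $i>\ell$. A labeling is a function from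 the multiset $\mathcal I^1\uplus\dots\uplus\mathcal I^k$ to $U$; it is feasible with respect to $(\sigma_1,\dots,\sigma_s)$ if for every $r\le s$ some interval containing $r$ is labeled $\sigma_r$. With $L^i_s$ the last interval of level $i$ of $\mathcal I_s$, $Q^\ell_s(p^{\ell+1},\dots,p^k)$ is the set of $p^\ell\in U$ such that some feasible labeling $\gamma$ of $\mathcal I_s$ with respect to $\rho_s$ satisfies $\gamma(L^i_s)=p^i$ for all $i\in\{\ell,\dots,k\}$. -}

module Defs where

open import Data.Nat using (ℕ; zero; suc; _+_; _≤_; _<_; _≤?_)
open import Data.Fin using (Fin; toℕ)
open import Data.Product using (Σ; ∃; _×_; _,_; proj₁; proj₂)
open import Data.List using (List; []; _∷_; _++_)
open import Data.List.Membership.Propositional using (_∈_)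
open import Relation.Binary.PropositionalEquality using (_≡_)
open import Relation.Nullary using (does)
open import Data.Bool using (if_then_else_)

-- An interval with integer endpoints, (a , b) stands for [a, b).
Interval : Set
Interval = ℕ × ℕ

_∈I_ : ℕ → Interval → Set
r ∈I J = proj₁ J ≤ r × r < proj₂ J

data Chain : ℕ → ℕ → List Interval → Set where
  done : ∀ {a} → Chain a a []
  step : ∀ {a b e xs} → a < b → Chain b e xs → Chain a e ((a , b) ∷ xs)

IsPartition : ℕ → List Interval → Set
IsPartition s xs = Chain 1 (suc s) xs

Refines : List Interval → List Interval → Set
Refines xs ys = ∀ J → J ∈ xs →
  Σ Interval λ J' → J' ∈ ys × proj₁ J' ≤ proj₁ J × proj₂ J ≤ proj₂ J'

-- A k-level pattern: level number (toℕ i + 1) for i : Fin k.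
Pattern : ℕ → Set
Pattern k = Fin k → List Interval

IsHSP : (k s : ℕ) → Pattern k → Set
IsHSP k s I =
  ((i : Fin k) → IsPartition s (I i)) ×
  ((i j : Fin k) → toℕ j ≡ suc (toℕ i) → Refines (I i) (I j))

IsLast : List Interval → Interval → Set
IsLast xs L = Σ (List Interval) λ ys → xs ≡ ys ++ (L ∷ [])

-- replace the last interval L by L ∪ [t, t+1)   (L = [a, t) in a pattern over [1,t))
extendLast : ℕ → List Interval → List Interval
extendLast t [] = []
extendLast t ((a , b) ∷ []) = (a , suc t) ∷ []
extendLast t (x ∷ y ∷ xs) = x ∷ extendLast t (y ∷ xs)

extension : {k : ℕ} → (ℓ t : ℕ) → Pattern k → Pattern k
extension ℓ t I i =
  if does (suc (toℕ i) ≤? ℓ)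
  then I i ++ ((t , suc t) ∷ [])
  else extendLast t (I i)

-- A labeling of the multiset I^1 ⊎ … ⊎ I^k: a label for each (level, interval).
Labeling : Set → ℕ → Set
Labeling U k = Fin k → Interval → U

Feasible : {U : Set} {k : ℕ} → Pattern k → Labeling U k → (s : ℕ) → (ℕ → U) → Set
Feasible {k = k} I γ s σ = (r : ℕ) → 1 ≤ r → r ≤ s →
  Σ (Fin k) λ i → Σ Interval λ J → J ∈ I i × r ∈I J × γ i J ≡ σ r

-- x ∈ Q^ℓ_s(p^{ℓ+1}, …, p^k) w.r.t. (I, σ_1..σ_s), where level ℓ is
-- the level number suc (toℕ j) and p i gives p^{level of i} (only used for levels > ℓ).
InQ : {U : Set} {k : ℕ} → Pattern k → (s : ℕ) → (ℕ → U) →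
      (j : Fin k) → (p : Fin k → U) → U → Set
InQ {U} {k} I s σ j p x = Σ (Labeling U k) λ γ → Feasible I γ s σ ×
  (∀ L → IsLast (I j) L → γ j L ≡ x) ×
  ((i : Fin k) → toℕ j < toℕ i → ∀ L → IsLast (I i) L → γ i L ≡ p i)

-- A feasible labeling γ of the ℓt-extension restricts to one of I: at levels ≤ ℓt the extension
-- only appends [t, t+1), so γ is kept; at levels > ℓt the last interval [a, t) grew into
-- [a, t+1) and inherits its label. A request r < t is never served by [t, t+1), and if it is
-- served by [a, t+1) then it is served by [a, t) with the same label; the last intervals of the
-- levels > ℓt, in particular those of levels ℓ, …, k, keep their labels.
module Submission where

open import Defs
open import Data.Nat using (ℕ; zero; suc; _≤_; _<_; _∸_; _≤?_; _≟_; s≤s)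
open import Data.Nat.Properties using (<-≤-trans; <⇒≤; <-trans; ≤-refl; <-irrefl; ≤⇒≯; m≤n⇒m≤1+n; <⇒≱)
open import Data.Fin using (Fin; toℕ)
open import Data.Product as Product using (∃; _×_; _,_; proj₁; proj₂)
open import Data.Sum using (inj₁; inj₂)
open import Data.List using ([]; _∷_; _++_)
open import Data.List.Relation.Unary.Any using (here; there)
open import Data.List.Membership.Propositional using (_∈_)
open import Data.List.Membership.Propositional.Properties using (∈-++⁻)
open import Relation.Binary.PropositionalEquality using (_≡_; refl; cong; subst; sym; module ≡-Reasoning)
open import Relation.Nullary using (yes; no; ¬_; contradiction)
open import Relation.Nullary.Decidable using (dec-true; dec-false)
open import Data.Bool using (if_then_else_)
open import Function using (id; _∘_)

Chain⇒≤ : ∀ {a e xs} → Chain a e xs → a ≤ e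
Chain⇒≤ done = ≤-refl
Chain⇒≤ (step a<b chain) = <⇒≤ (<-≤-trans a<b (Chain⇒≤ chain))

Chain-∷⇒< : ∀ {a e x xs} → Chain a e (x ∷ xs) → a < e
Chain-∷⇒< (step a<b chain) = <-≤-trans a<b (Chain⇒≤ chain)

Chain-last-end : ∀ {a e} ys L → Chain a e (ys ++ L ∷ []) → proj₂ L ≡ e
Chain-last-end []       L (step _ done)  = refl
Chain-last-end (_ ∷ ys) L (step _ chain) = Chain-last-end ys L chain

IsLast-end : ∀ {a e xs L} → Chain a e xs → IsLast xs L → proj₂ L ≡ e
IsLast-end chain (ys , refl) = Chain-last-end ys _ chain

IsLast-extendLast : ∀ t {xs a b} → IsLast xs (a , b) → IsLast (extendLast t xs) (a , suc t)
IsLast-extendLast t (ys , refl) = ys , go ys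
  where
  go : ∀ ys {a b} → extendLast t (ys ++ (a , b) ∷ []) ≡ ys ++ (a , suc t) ∷ []
  go []           = refl
  go (_ ∷ [])     = refl
  go (y ∷ z ∷ ys) = cong (y ∷_) (go (z ∷ ys))

stretch : ℕ → Interval → Interval
stretch t (a , b) with b ≟ t
... | yes _ = (a , suc t)
... | no _  = (a , b)

stretch-end : ∀ t a → stretch t (a , t) ≡ (a , suc t)
stretch-end t a with t ≟ t
... | yes _   = refl
... | no t≢t = contradiction refl t≢t

stretch-< : ∀ {t a b} → b < t → stretch t (a , b) ≡ (a , b)
stretch-< {t} {b = b} b<t with b ≟ t
... | yes refl = contradiction b<t (<-irrefl refl)
... | no _     = refl

∈-++-∷[]⁻ : ∀ {xs t r J} → J ∈ xs ++ (t , suc t) ∷ [] → r ∈I J → r < t → J ∈ xs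
∈-++-∷[]⁻ {xs} J∈ r∈J r<t with ∈-++⁻ xs J∈
... | inj₁ J∈xs        = J∈xs
... | inj₂ (here refl) = contradiction r<t (≤⇒≯ (proj₁ r∈J))

∈-extendLast⁻ : ∀ {a t xs r J} → Chain a t xs → J ∈ extendLast t xs → r ∈I J → r < t →
  ∃ λ J′ → J′ ∈ xs × r ∈I J′ × stretch t J′ ≡ J
∈-extendLast⁻ (step _ done) (here refl) (a≤r , _) r<t = _ , here refl , (a≤r , r<t) , stretch-end _ _
∈-extendLast⁻ (step _ chain@(step _ _)) (here refl) r∈J _ = _ , here refl , r∈J , stretch-< (Chain-∷⇒< chain)
∈-extendLast⁻ (step _ chain@(step _ _)) (there J∈) r∈J r<t =
  Product.map₂ (Product.map₁ there) (∈-extendLast⁻ chain J∈ r∈J r<t)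

-- The interval of level i of the ℓ-extension into which an interval of the original pattern grew.
stretchAt : {k : ℕ} → ℕ → ℕ → Fin k → Interval → Interval
stretchAt ℓ t i with suc (toℕ i) ≤? ℓ
... | yes _ = id
... | no _  = stretch t

stretchAt-≰ : ∀ {k ℓ t} {i : Fin k} → ¬ suc (toℕ i) ≤ ℓ → stretchAt ℓ t i ≡ stretch t
stretchAt-≰ {ℓ = ℓ} {i = i} stretched with suc (toℕ i) ≤? ℓ
... | yes appended = contradiction appended stretched
... | no _         = refl

module _ {k ℓ t : ℕ} {I : Pattern k} {i : Fin k} where

  extension-≤ : suc (toℕ i) ≤ ℓ → extension ℓ t I i ≡ I i ++ (t , suc t) ∷ []
  extension-≤ appended =
    cong (λ b → if b then I i ++ (t , suc t) ∷ [] else extendLast t (I i)) (dec-true (_ ≤? ℓ) appended)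

  extension-≰ : ¬ suc (toℕ i) ≤ ℓ → extension ℓ t I i ≡ extendLast t (I i)
  extension-≰ stretched =
    cong (λ b → if b then I i ++ (t , suc t) ∷ [] else extendLast t (I i)) (dec-false (_ ≤? ℓ) stretched)

  ∈-extension⁻ : ∀ {r J} → Chain 1 t (I i) → J ∈ extension ℓ t I i → r ∈I J → r < t →
    ∃ λ J′ → J′ ∈ I i × r ∈I J′ × stretchAt ℓ t i J′ ≡ J
  ∈-extension⁻ {J = J} chain J∈ r∈J r<t with suc (toℕ i) ≤? ℓ
  ... | yes appended = J , ∈-++-∷[]⁻ (subst (J ∈_) (extension-≤ appended) J∈) r∈J r<t , r∈J , refl
  ... | no stretched = ∈-extendLast⁻ chain (subst (J ∈_) (extension-≰ stretched) J∈) r∈J r<t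

module _ {U : Set} {k : ℕ} where

  restrict : ℕ → ℕ → Labeling U k → Labeling U k
  restrict ℓ t γ i = γ i ∘ stretchAt ℓ t i

  Feasible-restrict : ∀ {ℓ s σ γ} {I : Pattern k} → (∀ i → IsPartition s (I i)) →
    Feasible (extension ℓ (suc s) I) γ (suc s) σ → Feasible I (restrict ℓ (suc s) γ) s σ
  Feasible-restrict {ℓ} {I = I} partition feasible r 1≤r r≤s
    with feasible r 1≤r (m≤n⇒m≤1+n r≤s)
  ... | i , J , J∈ , r∈J , γJ≡σr with ∈-extension⁻ {ℓ = ℓ} {I = I} (partition i) J∈ r∈J (s≤s r≤s)
  ...   | J′ , J′∈ , r∈J′ , refl = i , J′ , J′∈ , r∈J′ , γJ≡σr

  lastLabel-restrict : ∀ {ℓ t γ y} {I : Pattern k} {i} → ℓ < suc (toℕ i) → Chain 1 t (I i) →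
    (∀ L → IsLast (extension ℓ t I i) L → γ i L ≡ y) →
    ∀ L → IsLast (I i) L → restrict ℓ t γ i L ≡ y
  lastLabel-restrict {ℓ} {t} {γ} {y} {I} {i} ℓ<i chain last-ext (a , b) L-last
    with IsLast-end chain L-last
  ... | refl = begin
    γ i (stretchAt ℓ t i (a , t)) ≡⟨ cong (λ f → γ i (f (a , t))) (stretchAt-≰ stretched) ⟩
    γ i (stretch t (a , t))       ≡⟨ cong (γ i) (stretch-end t a) ⟩
    γ i (a , suc t)               ≡⟨ last-ext (a , suc t) extended-last ⟩
    y                             ∎
    where
    open ≡-Reasoning
    stretched : ¬ suc (toℕ i) ≤ ℓ
    stretched = <⇒≱ ℓ<i
    extended-last : IsLast (extension ℓ t I i) (a , suc t)
    extended-last = subst (λ xs → IsLast xs (a , suc t)) (sym (extension-≰ {I = I} stretched))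
                          (IsLast-extendLast t L-last)

lemma2 : (U : Set) (k t : ℕ) → 1 ≤ k → 2 ≤ t → (σ : ℕ → U) →
    (I : Pattern k) → IsHSP k (t ∸ 1) I →
    (ℓt : ℕ) → ℓt ≤ k →
    (j : Fin k) → ℓt < suc (toℕ j) →
    (p : Fin k → U) (x : U) →
    InQ (extension ℓt t I) t σ j p x → InQ I (t ∸ 1) σ j p x
lemma2 _ _ zero _ () _ _ _ _ _ _ _ _ _ _
lemma2 U k (suc s) _ _ σ I (partition , _) ℓt _ j ℓt<j p x (γ , feasible , last-j , last-above) =
  restrict ℓt (suc s) γ ,
  Feasible-restrict {ℓ = ℓt} {I = I} partition feasible ,
  lastLabel-restrict {γ = γ} {I = I} ℓt<j (partition j) last-j ,
  λ i j<i → lastLabel-restrict {γ = γ} {I = I} (<-trans ℓt<j (s≤s j<i)) (partition i) (last-above i j<i)
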